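{- Let $R$ be a tolerance on a set $U$ induced by an irredundant covering $\mathcal{H}$ of $U$. Then $\mathcal{H}=\{R(x)\mid x\in U \text{ and } R(x)\text{ is a block of } R\}$.
   Context: A tolerance on $U$ is a reflexive symmetric binary relation; $R(x)=\{y\in U\mid x\,R\,y\}$. A preblock of $R$ is a nonempty $X\subseteq U$ with $X\times X\subseteq R$; a block is a maximal preblock (w.r.t. inclusion). A covering of $U$ is a family $\mathcal{H}$ of nonempty subsets of $U$ with $\bigcup\mathcal{H}=U$; it is irredundant if $\mathcal{H}\setminus\{X\}$ is not a covering of $U$ for any $X\in\mathcal{H}$. The tolerance induced by $\mathcal{H}$ is $R_{\mathcal{H}}=\bigcup\{X\times X\mid X\in\mathcal{H}\}$. -}

module Defs where

open import Level using (Level; _⊔_) renaming (suc to lsuc)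
open import Data.Product using (Σ; ∃; ∃-syntax; _×_; _,_)
open import Relation.Nullary using (¬_)
open import Relation.Unary using (Pred; _∈_; _⊆_; _≐_)
open import Relation.Binary using (Rel)

-- A family of subsets of U, given as an indexed family  H : I → Pred U ℓ.
-- Two subsets are equal when they are extensionally equal (_≐_).

_⟨_⟩ : ∀ {ℓ} {U : Set ℓ} → Rel U ℓ → U → Pred U ℓ
(R ⟨ x ⟩) y = R x y

IsPreblock : ∀ {ℓ} {U : Set ℓ} → Rel U ℓ → Pred U ℓ → Set ℓ
IsPreblock {U = U} R X = (∃[ u ] u ∈ X) × (∀ {x y} → x ∈ X → y ∈ X → R x y)

IsBlock : ∀ {ℓ} {U : Set ℓ} → Rel U ℓ → Pred U ℓ → Set (lsuc ℓ)
IsBlock {ℓ} {U} R X =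
  IsPreblock R X × ((Y : Pred U ℓ) → IsPreblock R Y → X ⊆ Y → Y ⊆ X)

IsCovering : ∀ {ℓ} {U I : Set ℓ} → (I → Pred U ℓ) → Set ℓ
IsCovering {U = U} {I} H = (∀ i → ∃[ u ] u ∈ H i) × (∀ (u : U) → ∃[ i ] u ∈ H i)

-- Irredundant covering: a covering such that for every member X = H i,
-- the family H \ {X} (all indices j whose member differs from X) no longer
-- covers U.  (H \ {X} consists of nonempty sets, so it fails to be a covering
-- exactly when its union is not U.)
IsIrredundantCovering : ∀ {ℓ} {U I : Set ℓ} → (I → Pred U ℓ) → Set ℓ
IsIrredundantCovering {U = U} {I} H =
  IsCovering H ×
  (∀ i → ¬ (∀ (u : U) → ∃[ j ] (¬ (H j ≐ H i) × u ∈ H j)))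

R[_] : ∀ {ℓ} {U I : Set ℓ} → (I → Pred U ℓ) → Rel U ℓ
R[_] {I = I} H x y = ∃[ i ] (x ∈ H i × y ∈ H i)

module Submission where

-- Irredundancy means every member H i has a private element p, one lying only
-- in members equal to H i. Then R⟨p⟩ = H i, and R⟨p⟩ is a block since any preblock
-- containing it contains p. Conversely, if R⟨x⟩ is a block and x ∈ H i with
-- private p, then p ∈ R⟨x⟩, so every y ∈ R⟨x⟩ is related to p, i.e. y ∈ H i.

open import Defs
open import Axiom.ExcludedMiddle using (ExcludedMiddle)
open import Axiom.DoubleNegationElimination using (DoubleNegationElimination; em⇒dne)
open import Data.Product using (∃; ∃-syntax; _×_; _,_; proj₁)
open import Relation.Unary using (Pred; _∈_; _⊆_; _≐_)
open import Relation.Binary using (Rel)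

IsPrivateIn : ∀ {ℓ} {U I : Set ℓ} → (I → Pred U ℓ) → I → U → Set ℓ
IsPrivateIn H i p = ∀ j → p ∈ H j → H j ≐ H i

neighbourhood-isBlock : ∀ {ℓ} {U : Set ℓ} {R : Rel U ℓ} {x : U} → x ∈ R ⟨ x ⟩ →
  (∀ {y z} → y ∈ R ⟨ x ⟩ → z ∈ R ⟨ x ⟩ → R y z) → IsBlock R (R ⟨ x ⟩)
neighbourhood-isBlock x∈Rx related =
  ((_ , x∈Rx) , related) , λ Y (_ , relatedY) Rx⊆Y y∈Y → relatedY (Rx⊆Y x∈Rx) y∈Y

module _ {ℓ} {U I : Set ℓ} (H : I → Pred U ℓ) where

  member⊆neighbourhood : ∀ {i x} → x ∈ H i → H i ⊆ R[ H ] ⟨ x ⟩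
  member⊆neighbourhood {i} x∈Hi y∈Hi = i , x∈Hi , y∈Hi

  private⇒neighbourhood⊆member : ∀ {i p} → IsPrivateIn H i p → R[ H ] ⟨ p ⟩ ⊆ H i
  private⇒neighbourhood⊆member private-p (j , p∈Hj , y∈Hj) = proj₁ (private-p j p∈Hj) y∈Hj

  private⇒member : ∀ {i p} → IsPrivateIn H i p → ∃[ j ] p ∈ H j → p ∈ H i
  private⇒member private-p (j , p∈Hj) = proj₁ (private-p j p∈Hj) p∈Hj

  private⇒neighbourhood≐member : ∀ {i p} → IsPrivateIn H i p → p ∈ H i →
    H i ≐ R[ H ] ⟨ p ⟩
  private⇒neighbourhood≐member private-p p∈Hi =
    member⊆neighbourhood p∈Hi , private⇒neighbourhood⊆member private-p

  irredundant⇒private : DoubleNegationElimination ℓ → IsIrredundantCovering H →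
    ∀ i → ∃[ p ] IsPrivateIn H i p
  irredundant⇒private dne (_ , irredundant) i =
    dne λ no-private → irredundant i λ u →
      dne λ u-only-in-copies → no-private
        (u , λ j u∈Hj → dne λ Hj≉Hi → u-only-in-copies (j , Hj≉Hi , u∈Hj))

lemma3p1 : ∀ {ℓ} → ExcludedMiddle ℓ → {U I : Set ℓ} (H : I → Pred U ℓ) →
    IsIrredundantCovering H →
    (∀ i → ∃[ x ] ((H i ≐ (R[ H ] ⟨ x ⟩)) × IsBlock R[ H ] (R[ H ] ⟨ x ⟩))) ×
    (∀ x → IsBlock R[ H ] (R[ H ] ⟨ x ⟩) → ∃[ i ] (H i ≐ (R[ H ] ⟨ x ⟩)))
lemma3p1 em H irr@((_ , covers) , _) = member⇒block , block⇒member
  where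
  privateElement : ∀ i → ∃[ p ] (IsPrivateIn H i p × p ∈ H i)
  privateElement i with irredundant⇒private H (em⇒dne em) irr i
  ... | p , private-p = p , private-p , private⇒member H private-p (covers p)

  member⇒block : ∀ i → ∃[ x ] ((H i ≐ (R[ H ] ⟨ x ⟩)) × IsBlock R[ H ] (R[ H ] ⟨ x ⟩))
  member⇒block i with privateElement i
  ... | p , private-p , p∈Hi with private⇒neighbourhood≐member H private-p p∈Hi
  ... | Hi≐Rp@(_ , Rp⊆Hi) =
    p , Hi≐Rp , neighbourhood-isBlock (i , p∈Hi , p∈Hi) λ y z → i , Rp⊆Hi y , Rp⊆Hi z

  block⇒member : ∀ x → IsBlock R[ H ] (R[ H ] ⟨ x ⟩) → ∃[ i ] (H i ≐ (R[ H ] ⟨ x ⟩))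
  block⇒member x ((_ , related) , _) with covers x
  ... | i , x∈Hi with privateElement i
  ... | p , private-p , p∈Hi =
    i , member⊆neighbourhood H x∈Hi ,
    λ y∈Rx → private⇒neighbourhood⊆member H private-p (related (i , x∈Hi , p∈Hi) y∈Rx)
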